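{- Let $\mathcal{H}$ be a hereditary graph class that is closed under 1-clique-sums, and let $k\in\mathbb{N}$. Then every connected component of every minor-obstruction of $\mathcal{H}^{\langle k\rangle}$ is 2-connected.
   Context: A graph class is hereditary if it is closed under vertex deletion. It is closed under 1-clique-sums if it is closed under disjoint union and, for any two of its graphs $G,G'$, the graph obtained by identifying a vertex of $G$ with a vertex of $G'$ is also in the class. For $k\in\mathbb{N}$, $\mathcal{H}^{\langle k\rangle}$ is the class of graphs $G$ for which there exists $X\subseteq V(G)$ with $|X|\le k$ and $G-X\in\mathcal{H}$. A minor-obstruction of a class $\mathcal{C}$ is a graph not in $\mathcal{C}$ all of whose proper minors are in $\mathcal{C}$. A graph $H$ is 2-connected if $H-X$ is connected for every set $X$ of at most one vertex. -}

module Defs where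

open import Data.Nat using (ℕ; _≤_)
open import Data.Fin using (Fin)
open import Data.Bool using (Bool; true; false)
open import Data.Maybe using (Maybe; just)
open import Data.List using (List; length)
open import Data.List.Membership.Propositional using (_∈_; _∉_)
open import Data.Product using (Σ; ∃; ∃-syntax; _×_; _,_)
open import Data.Sum using (_⊎_)
open import Data.Unit using (⊤)
open import Relation.Nullary using (¬_)
open import Relation.Binary.PropositionalEquality using (_≡_; _≢_)

record Graph : Set where
  field
    n      : ℕ
    adj    : Fin n → Fin n → Bool
    sym    : ∀ u v → adj u v ≡ adj v u
    irrefl : ∀ u → adj u u ≡ false
open Graph public

V : Graph → Set
V G = Fin (n G)

Edge : (G : Graph) → V G → V G → Set
Edge G u v = adj G u v ≡ true

record InducedOn (H G : Graph) (S : V G → Set) : Set where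
  field
    f       : V H → V G
    f-inj   : ∀ a b → f a ≡ f b → a ≡ b
    f-into  : ∀ a → S (f a)
    f-onto  : ∀ v → S v → ∃[ a ] f a ≡ v
    f-adj   : ∀ a b → adj H a b ≡ adj G (f a) (f b)

_≅_ : Graph → Graph → Set
G ≅ H = InducedOn H G (λ _ → ⊤)

GraphClass : Set₁
GraphClass = Graph → Set

IsoClosed : GraphClass → Set
IsoClosed 𝓒 = ∀ G H → G ≅ H → 𝓒 G → 𝓒 H

Hereditary : GraphClass → Set
Hereditary 𝓒 = ∀ G (v : V G) H → InducedOn H G (λ u → u ≢ v) → 𝓒 G → 𝓒 H

-- G is a union of (copies of) G₁ and G₂: both embed as induced subgraphs,
-- they cover V(G), and every edge of G lies inside one of the two copies.
record Union (G₁ G₂ G : Graph) : Set where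
  field
    f₁     : V G₁ → V G
    f₂     : V G₂ → V G
    f₁-inj : ∀ a b → f₁ a ≡ f₁ b → a ≡ b
    f₂-inj : ∀ a b → f₂ a ≡ f₂ b → a ≡ b
    f₁-adj : ∀ a b → adj G₁ a b ≡ adj G (f₁ a) (f₁ b)
    f₂-adj : ∀ a b → adj G₂ a b ≡ adj G (f₂ a) (f₂ b)
    cover  : ∀ v → (∃[ a ] f₁ a ≡ v) ⊎ (∃[ b ] f₂ b ≡ v)
    edges  : ∀ a b → Edge G (f₁ a) (f₂ b) →
             (∃[ b' ] f₁ b' ≡ f₂ b) ⊎ (∃[ a' ] f₂ a' ≡ f₁ a)
open Union public

IsDisjointUnion : Graph → Graph → Graph → Set
IsDisjointUnion G₁ G₂ G = Σ (Union G₁ G₂ G) λ U → ∀ a b → f₁ U a ≢ f₂ U b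

IsVertexIdentification : (G₁ G₂ : Graph) → V G₁ → V G₂ → Graph → Set
IsVertexIdentification G₁ G₂ x₁ x₂ G =
  Σ (Union G₁ G₂ G) λ U →
    (f₁ U x₁ ≡ f₂ U x₂) × (∀ a b → f₁ U a ≡ f₂ U b → (a ≡ x₁) × (b ≡ x₂))

ClosedUnder1CliqueSums : GraphClass → Set
ClosedUnder1CliqueSums 𝓒 =
  (∀ G₁ G₂ G → 𝓒 G₁ → 𝓒 G₂ → IsDisjointUnion G₁ G₂ G → 𝓒 G) ×
  (∀ G₁ G₂ x₁ x₂ G → 𝓒 G₁ → 𝓒 G₂ → IsVertexIdentification G₁ G₂ x₁ x₂ G → 𝓒 G)

Apex : GraphClass → ℕ → GraphClass
Apex 𝓗 k G = ∃[ X ] (length {A = V G} X ≤ k) ×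
               (∃[ H ] InducedOn H G (λ v → v ∉ X) × 𝓗 H)

data Reach (G : Graph) (S : V G → Set) (u : V G) : V G → Set where
  here : S u → Reach G S u u
  step : ∀ {v w} → Reach G S u v → Edge G v w → S w → Reach G S u w

-- S is connected (any two vertices of S joined by a path inside S;
-- the empty set counts as connected).
ConnectedOn : (G : Graph) → (V G → Set) → Set
ConnectedOn G S = ∀ u v → S u → S v → Reach G S u v

Connected : Graph → Set
Connected G = ConnectedOn G (λ _ → ⊤)

TwoConnected : Graph → Set
TwoConnected H = ∀ (X : List (V H)) → length X ≤ 1 → ConnectedOn H (λ v → v ∉ X)

-- Connected component: nonempty, connected, closed under adjacency (i.e. maximal).
IsComponent : (G : Graph) → (V G → Set) → Set
IsComponent G C = (∃[ v ] C v) × ConnectedOn G C × (∀ u v → C u → Edge G u v → C v)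

-- Minor via a minor model: φ v = just h means v lies in branch set of h.
record Minor (H G : Graph) : Set where
  field
    φ        : V G → Maybe (V H)
    nonempty : ∀ h → ∃[ v ] φ v ≡ just h
    conn     : ∀ h → ConnectedOn G (λ v → φ v ≡ just h)
    edge     : ∀ h h' → Edge H h h' →
               ∃[ u ] ∃[ v ] (φ u ≡ just h) × (φ v ≡ just h') × Edge G u v

ProperMinor : Graph → Graph → Set
ProperMinor H G = Minor H G × ¬ (H ≅ G)

MinorObstruction : GraphClass → Graph → Set
MinorObstruction 𝓒 G = ¬ 𝓒 G × (∀ H → ProperMinor H G → 𝓒 H)

{-# OPTIONS --safe #-}
-- Suppose a vertex x of the component C separated two vertices u, w of C − x. Let A be the set of
-- vertices reachable from u in G − x (a decidable set, since reachability in a finite graph is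
-- decidable) and B the vertices outside A ∪ {x}; x has neighbours in both. Deleting the edges between
-- x and A, resp. between x and B, gives proper minors of G, hence apex sets X₁, X₂ of size at most k.
-- Then G − Y₁ with Y₁ = (X₂ ∩ (A ∪ {x})) ∪ (X₁ ∖ A) is a 1-sum at x, and G − Y₂ with
-- Y₂ = {x} ∪ (X₁ ∩ A) ∪ (X₂ ∩ B) a disjoint union, of induced subgraphs of the two solutions, so both
-- lie in 𝓗. As |Y₁| + |Y₂| = |X₁| + |X₂| + 1 ≤ 2k + 1, one of Y₁, Y₂ shows G ∈ 𝓗^⟨k⟩, a contradiction.

module Submission where

open import Defs hiding (sym)
open import Level using (Level)
open import Data.Bool using (true; not; _∧_)
open import Data.Bool.Properties using (∧-zeroʳ) renaming (_≟_ to _≟ᵇ_)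
open import Data.Empty using (⊥; ⊥-elim)
open import Data.Maybe using (just)
open import Data.Fin using (Fin; zero; suc; combine; remQuot)
open import Data.Fin.Properties
  using (_≟_; any?; all?; ¬∀⟶∃¬; suc-injective; injective⇒≤; combine-injective; remQuot-combine; combine-remQuot)
open import Data.List using (List; []; _∷_; _++_; length; filter)
open import Data.List.Properties using (length-++)
open import Data.List.Membership.Propositional using (_∈_; _∉_)
open import Data.List.Membership.Propositional.Properties using (∈-filter⁺; ∈-++⁺ˡ; ∈-++⁺ʳ)
import Data.List.Relation.Unary.Any as Any
open import Data.Nat using (ℕ; zero; suc; _+_; _*_; _≤_; _<_; s≤s; _≤?_)
open import Data.Nat.Properties
  using (≤-trans; <-≤-trans; ≤-<-trans; <-irrefl; +-suc; +-monoʳ-≤; +-monoˡ-≤; +-mono-≤; +-cancelˡ-≤; m≤m+n; ≰⇒>)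
open import Data.Nat.Induction using (<-wellFounded)
open import Data.Nat.Solver using (module +-*-Solver)
open import Data.Product using (∃-syntax; _×_; _,_; proj₁; proj₂)
open import Data.Unit using (tt)
open import Data.Sum using (_⊎_; inj₁; inj₂; [_,_]; swap)
import Data.Sum as Sum
open import Function using (_∘_; id)
open import Function.Bundles using (mk⇔)
open import Induction.WellFounded using (Acc; acc)
open import Relation.Binary.Definitions using (Symmetric) renaming (Decidable to Decidable₂)
open import Relation.Binary.PropositionalEquality
  using (_≡_; _≢_; refl; sym; trans; cong; cong₂; subst; module ≡-Reasoning)
open import Relation.Nullary using (¬_; Dec; yes; no; does; ¬?; _×-dec_; _⊎-dec_)
open import Relation.Nullary.Decidable using (map′; decidable-stable; does-⇔; dec-true; dec-false)
open import Relation.Unary using (Pred; Decidable; _⊆_; ∁)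
open import Relation.Unary.Properties using (U?; ∁?)

private variable
  ℓ ℓ′ : Level

-- Counting and enumerating decidable subsets of Fin N

count : ∀ {N} {P : Pred (Fin N) ℓ} → Decidable P → ℕ
count {N = zero}  P? = 0
count {N = suc N} P? with P? zero
... | yes _ = suc (count (P? ∘ suc))
... | no  _ = count (P? ∘ suc)

enum : ∀ {N} {P : Pred (Fin N) ℓ} (P? : Decidable P) → Fin (count P?) → Fin N
enum {N = suc N} P? i with P? zero
enum {N = suc N} P? zero    | yes _ = zero
enum {N = suc N} P? (suc i) | yes _ = suc (enum (P? ∘ suc) i)
enum {N = suc N} P? i       | no  _ = suc (enum (P? ∘ suc) i)

enum-∈ : ∀ {N} {P : Pred (Fin N) ℓ} (P? : Decidable P) i → P (enum P? i)
enum-∈ {N = suc N} P? i with P? zero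
enum-∈ {N = suc N} P? zero    | yes P0 = P0
enum-∈ {N = suc N} P? (suc i) | yes _  = enum-∈ (P? ∘ suc) i
enum-∈ {N = suc N} P? i       | no  _  = enum-∈ (P? ∘ suc) i

enum-injective : ∀ {N} {P : Pred (Fin N) ℓ} (P? : Decidable P) i j → enum P? i ≡ enum P? j → i ≡ j
enum-injective {N = suc N} P? i j eq with P? zero
enum-injective {N = suc N} P? zero    zero    eq | yes _ = refl
enum-injective {N = suc N} P? (suc i) (suc j) eq | yes _ =
  cong suc (enum-injective (P? ∘ suc) i j (suc-injective eq))
enum-injective {N = suc N} P? i       j       eq | no  _ = enum-injective (P? ∘ suc) i j (suc-injective eq)

enum-surjective : ∀ {N} {P : Pred (Fin N) ℓ} (P? : Decidable P) v → P v → ∃[ i ] enum P? i ≡ v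
enum-surjective {N = suc N} P? v Pv with P? zero
enum-surjective {N = suc N} P? zero    Pv | yes _   = zero , refl
enum-surjective {N = suc N} P? (suc v) Pv | yes _   =
  let i , eq = enum-surjective (P? ∘ suc) v Pv in suc i , cong suc eq
enum-surjective {N = suc N} P? zero    Pv | no  ¬P0 = ⊥-elim (¬P0 Pv)
enum-surjective {N = suc N} P? (suc v) Pv | no  _   =
  let i , eq = enum-surjective (P? ∘ suc) v Pv in i , cong suc eq

count≤N : ∀ {N} {P : Pred (Fin N) ℓ} (P? : Decidable P) → count P? ≤ N
count≤N P? = injective⇒≤ (λ {i} {j} → enum-injective P? i j)

count-mono-injective : ∀ {M N} {P : Pred (Fin M) ℓ} {Q : Pred (Fin N) ℓ′} (P? : Decidable P) (Q? : Decidable Q)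
  (g : Fin M → Fin N) → (∀ a b → g a ≡ g b → a ≡ b) → (∀ {a} → P a → Q (g a)) → count P? ≤ count Q?
count-mono-injective P? Q? g g-injective P⇒Q = injective⇒≤ {f = proj₁ ∘ preimage} preimage-injective
  where
  preimage : ∀ i → ∃[ j ] enum Q? j ≡ g (enum P? i)
  preimage i = enum-surjective Q? _ (P⇒Q (enum-∈ P? i))
  preimage-injective : ∀ {i j} → proj₁ (preimage i) ≡ proj₁ (preimage j) → i ≡ j
  preimage-injective {i} {j} eq = enum-injective P? i j (g-injective _ _
    (trans (sym (proj₂ (preimage i))) (trans (cong (enum Q?) eq) (proj₂ (preimage j)))))

count-mono : ∀ {N} {P : Pred (Fin N) ℓ} {Q : Pred (Fin N) ℓ′} (P? : Decidable P) (Q? : Decidable Q) →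
  P ⊆ Q → count P? ≤ count Q?
count-mono P? Q? P⊆Q = count-mono-injective P? Q? id (λ _ _ → id) P⊆Q

count-< : ∀ {N} {P : Pred (Fin N) ℓ} {Q : Pred (Fin N) ℓ′} (P? : Decidable P) (Q? : Decidable Q) →
  P ⊆ Q → ∀ {j} → Q j → ¬ P j → count P? < count Q?
count-< {N = suc N} P? Q? P⊆Q {j} Qj ¬Pj with P? zero | Q? zero
... | yes P0 | no ¬Q0 = ⊥-elim (¬Q0 (P⊆Q P0))
... | no  _  | yes _  = s≤s (count-mono (P? ∘ suc) (Q? ∘ suc) P⊆Q)
count-< {N = suc N} P? Q? P⊆Q {zero}  Qj ¬Pj | yes P0 | yes _  = ⊥-elim (¬Pj P0)
count-< {N = suc N} P? Q? P⊆Q {suc j} Qj ¬Pj | yes _  | yes _  = s≤s (count-< (P? ∘ suc) (Q? ∘ suc) P⊆Q Qj ¬Pj)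
count-< {N = suc N} P? Q? P⊆Q {zero}  Qj ¬Pj | no  _  | no ¬Q0 = ⊥-elim (¬Q0 Qj)
count-< {N = suc N} P? Q? P⊆Q {suc j} Qj ¬Pj | no  _  | no _   = count-< (P? ∘ suc) (Q? ∘ suc) P⊆Q Qj ¬Pj

count<N : ∀ {N} {P : Pred (Fin N) ℓ} (P? : Decidable P) {j} → ¬ P j → count P? < N
count<N P? ¬Pj = <-≤-trans (count-< P? U? (λ _ → tt) tt ¬Pj) (count≤N U?)

-- Induced subgraphs and induced embeddings

edge-sym : (G : Graph) {u v : V G} → Edge G u v → Edge G v u
edge-sym G {u} {v} e = trans (Graph.sym G v u) e

induced : (G : Graph) {S : V G → Set} → Decidable S → Graph
induced G S? = record
  { n      = count S?
  ; adj    = λ a b → adj G (enum S? a) (enum S? b)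
  ; sym    = λ a b → Graph.sym G (enum S? a) (enum S? b)
  ; irrefl = λ a → irrefl G (enum S? a)
  }

induced-InducedOn : (G : Graph) {S : V G → Set} (S? : Decidable S) → InducedOn (induced G S?) G S
induced-InducedOn G S? = record
  { f = enum S? ; f-inj = enum-injective S? ; f-into = enum-∈ S? ; f-onto = enum-surjective S? ; f-adj = λ _ _ → refl }

_∖_ : (G : Graph) → List (V G) → Graph
G ∖ Y = induced G (λ z → ¬? (Any.any? (z ≟_) Y))

∖-InducedOn : (G : Graph) (Y : List (V G)) → InducedOn (G ∖ Y) G (_∉ Y)
∖-InducedOn G Y = induced-InducedOn G (λ z → ¬? (Any.any? (z ≟_) Y))

record _↪_ (H G : Graph) : Set where
  field
    embed           : V H → V G
    embed-injective : ∀ a b → embed a ≡ embed b → a ≡ b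
    embed-adj       : ∀ a b → adj H a b ≡ adj G (embed a) (embed b)
open _↪_

InducedOn⇒↪ : ∀ {H G S} → InducedOn H G S → H ↪ G
InducedOn⇒↪ ι = record
  { embed = InducedOn.f ι ; embed-injective = InducedOn.f-inj ι ; embed-adj = InducedOn.f-adj ι }

↪-trans : ∀ {K H G} → K ↪ H → H ↪ G → K ↪ G
↪-trans e e′ = record
  { embed           = embed e′ ∘ embed e
  ; embed-injective = λ a b eq → embed-injective e a b (embed-injective e′ _ _ eq)
  ; embed-adj       = λ a b → trans (embed-adj e a b) (embed-adj e′ _ _)
  }

↪-factor : ∀ {K T G S} (e : K ↪ G) → InducedOn T G S → (∀ a → S (embed e a)) → K ↪ T
↪-factor {G = G} e ι S-image = record
  { embed           = proj₁ ∘ preimage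
  ; embed-injective = λ a b eq → embed-injective e a b
      (trans (sym (proj₂ (preimage a))) (trans (cong ι.f eq) (proj₂ (preimage b))))
  ; embed-adj       = λ a b → trans (embed-adj e a b)
      (trans (cong₂ (adj G) (sym (proj₂ (preimage a))) (sym (proj₂ (preimage b)))) (sym (ι.f-adj _ _)))
  }
  where
  module ι = InducedOn ι
  preimage : ∀ a → ∃[ t ] ι.f t ≡ embed e a
  preimage a = ι.f-onto (embed e a) (S-image a)

module _ {𝓗 : GraphClass} (iso : IsoClosed 𝓗) (her : Hereditary 𝓗) where

  ↪-closed : ∀ {H G} → H ↪ G → 𝓗 G → 𝓗 H
  ↪-closed {H} {G} = go G (<-wellFounded (n G))
    where
    go : ∀ G → Acc _<_ (n G) → H ↪ G → 𝓗 G → 𝓗 H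
    go G (acc smaller) e G∈𝓗 with all? (λ v → any? (λ a → embed e a ≟ v))
    ... | yes onto = iso G H iso-GH G∈𝓗
      where
      iso-GH : G ≅ H
      iso-GH = record
        { f = embed e ; f-inj = embed-injective e ; f-into = λ _ → tt ; f-onto = λ v _ → onto v ; f-adj = embed-adj e }
    ... | no ¬onto with ¬∀⟶∃¬ _ _ (λ v → any? (λ a → embed e a ≟ v)) ¬onto
    ... | v , v∉image =
      go G-v (smaller (count<N ≢v? (λ v≢v → v≢v refl))) (↪-factor e ι missed) (her G v G-v ι G∈𝓗)
      where
      missed : ∀ a → embed e a ≢ v
      missed a eq = v∉image (a , eq)
      ≢v? : Decidable (_≢ v)
      ≢v? u = ¬? (u ≟ v)
      G-v = induced G ≢v?
      ι = induced-InducedOn G ≢v?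

-- Walks

reach-end : ∀ {G S u v} → Reach G S u v → S v
reach-end (here Su)     = Su
reach-end (step _ _ Sv) = Sv

reach-∩ : ∀ {G : Graph} {T C : V G → Set} {u v} → (∀ y z → C y → Edge G y z → C z) →
  C u → Reach G T u v → Reach G (λ z → T z × C z) u v
reach-∩ C-closed Cu (here Tu)      = here (Tu , Cu)
reach-∩ C-closed Cu (step r e Tz) =
  let r′ = reach-∩ C-closed Cu r in step r′ e (Tz , C-closed _ _ (proj₂ (reach-end r′)) e)

reach-pullback : ∀ {H G : Graph} {C T : V G → Set} {S : V H → Set} (ι : InducedOn H G C) →
  (∀ {z} → T z → C z) → (∀ {a} → T (InducedOn.f ι a) → S a) →
  ∀ {a b} → Reach G T (InducedOn.f ι a) (InducedOn.f ι b) → Reach H S a b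
reach-pullback {H} {G} {T = T} {S} ι T⊆C T⇒S {a} r = go r _ refl
  where
  open InducedOn ι
  go : ∀ {y} → Reach G T (f a) y → ∀ b → f b ≡ y → Reach H S a b
  go (here Tfa) b fb≡fa with f-inj b a fb≡fa
  ... | refl = here (T⇒S Tfa)
  go (step {v} r e Tfb) b refl =
    let v′ , fv′≡v = f-onto v (T⊆C (reach-end r))
    in step (go r v′ fv′≡v) (trans (f-adj v′ b) (trans (cong (λ w → adj G w (f b)) fv′≡v) e)) (T⇒S Tfb)

ClosedAwayFrom : (G : Graph) → V G → (V G → Set) → Set
ClosedAwayFrom G x D = ∀ {y z} → D y → Edge G y z → z ≢ x → D z

exit-neighbour : ∀ {G : Graph} {x : V G} {D T : V G → Set} → ¬ D x → ClosedAwayFrom G x D →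
  ∀ {z} → Reach G T x z → D z → ∃[ y ] D y × Edge G x y
exit-neighbour ¬Dx D-closed (here _) Dx = ⊥-elim (¬Dx Dx)
exit-neighbour {G} {x} ¬Dx D-closed (step {v} {z} r e _) Dz with v ≟ x
... | yes refl = z , Dz , e
... | no v≢x   = exit-neighbour ¬Dx D-closed r (D-closed Dz (edge-sym G e) v≢x)

increasing-chain-stabilises : ∀ {N} {P : ℕ → Pred (Fin N) ℓ} (P? : ∀ k → Decidable (P k)) →
  (∀ k → P k ⊆ P (suc k)) → ∃[ k ] P (suc k) ⊆ P k
increasing-chain-stabilises {N = N} {P = P} P? increasing = go N 0 (m≤m+n N _)
  where
  go : ∀ m k → N ≤ m + count (P? k) → ∃[ k ] P (suc k) ⊆ P k
  go m k bound with any? (λ z → P? (suc k) z ×-dec ¬? (P? k z))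
  ... | no ¬new = k , λ {z} Pz → decidable-stable (P? k z) (λ ¬Pz → ¬new (z , Pz , ¬Pz))
  ... | yes (z , new , ¬old) with m | count-< (P? k) (P? (suc k)) (increasing k) new ¬old
  ...   | zero  | grows = ⊥-elim (<-irrefl refl (<-≤-trans (≤-<-trans bound grows) (count≤N (P? (suc k)))))
  ...   | suc m | grows =
    go m (suc k) (≤-trans bound (subst (_≤ m + count (P? (suc k))) (+-suc m _) (+-monoʳ-≤ m grows)))

module _ (G : Graph) {S : V G → Set} (S? : Decidable S) (u : V G) where

  ReachWithin : ℕ → V G → Set
  ReachWithin zero    z = u ≡ z × S z
  ReachWithin (suc k) z = ReachWithin k z ⊎ (S z × ∃[ y ] ReachWithin k y × Edge G y z)

  ReachWithin? : ∀ k → Decidable (ReachWithin k)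
  ReachWithin? zero    z = (u ≟ z) ×-dec S? z
  ReachWithin? (suc k) z =
    ReachWithin? k z ⊎-dec (S? z ×-dec any? (λ y → ReachWithin? k y ×-dec (adj G y z ≟ᵇ true)))

  ReachWithin⇒Reach : ∀ k {z} → ReachWithin k z → Reach G S u z
  ReachWithin⇒Reach zero    (refl , Su)              = here Su
  ReachWithin⇒Reach (suc k) (inj₁ r)                 = ReachWithin⇒Reach k r
  ReachWithin⇒Reach (suc k) (inj₂ (Sz , y , r , e)) = step (ReachWithin⇒Reach k r) e Sz

  Reach⇒ReachWithin : ∀ k → ReachWithin (suc k) ⊆ ReachWithin k → ∀ {z} → Reach G S u z → ReachWithin k z
  Reach⇒ReachWithin k stable (here Su)      = start k
    where
    start : ∀ k → ReachWithin k u
    start zero    = refl , Su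
    start (suc k) = inj₁ (start k)
  Reach⇒ReachWithin k stable (step r e Sz) = stable (inj₂ (Sz , _ , Reach⇒ReachWithin k stable r , e))

  reach? : ∀ v → Dec (Reach G S u v)
  reach? v with increasing-chain-stabilises ReachWithin? (λ k → inj₁)
  ... | k , stable = map′ (ReachWithin⇒Reach k) (Reach⇒ReachWithin k stable) (ReachWithin? k v)

-- Deleting edges

EdgeCode : (G : Graph) → Fin (n G * n G) → Set
EdgeCode G i = Edge G (proj₁ (remQuot {n G} (n G) i)) (proj₂ (remQuot {n G} (n G) i))

EdgeCode? : (G : Graph) → Decidable (EdgeCode G)
EdgeCode? G i = adj G _ _ ≟ᵇ true

edgeCount : Graph → ℕ
edgeCount G = count (EdgeCode? G)

module _ (G : Graph) {u v : V G} where

  EdgeCode-combine⁺ : Edge G u v → EdgeCode G (combine u v)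
  EdgeCode-combine⁺ = subst (λ (p , q) → Edge G p q) (sym (remQuot-combine {n G} {n G} u v))

  EdgeCode-combine⁻ : EdgeCode G (combine u v) → Edge G u v
  EdgeCode-combine⁻ = subst (λ (p , q) → Edge G p q) (remQuot-combine {n G} {n G} u v)

edgeCount-↪ : ∀ {H G} → H ↪ G → edgeCount H ≤ edgeCount G
edgeCount-↪ {H} {G} e = count-mono-injective (EdgeCode? H) (EdgeCode? G) code code-injective
  (λ {i} E → EdgeCode-combine⁺ G (trans (sym (embed-adj e _ _)) E))
  where
  code : Fin (n H * n H) → Fin (n G * n G)
  code i = combine (embed e (proj₁ (remQuot {n H} (n H) i))) (embed e (proj₂ (remQuot {n H} (n H) i)))
  code-injective : ∀ i j → code i ≡ code j → i ≡ j
  code-injective i j eq =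
    let p≡ , q≡ = combine-injective _ _ _ _ eq
    in trans (sym (combine-remQuot {n H} (n H) i))
         (trans (cong₂ combine (embed-injective e _ _ p≡) (embed-injective e _ _ q≡)) (combine-remQuot {n H} (n H) j))

deleteEdges : (G : Graph) {R : V G → V G → Set} → Decidable₂ R → Symmetric R → Graph
deleteEdges G R? R-sym = record
  { n      = n G
  ; adj    = λ p q → not (does (R? p q)) ∧ adj G p q
  ; sym    = λ p q → cong₂ _∧_ (cong not (does-⇔ (mk⇔ R-sym R-sym) (R? p q) (R? q p))) (Graph.sym G p q)
  ; irrefl = λ p → trans (cong (_ ∧_) (irrefl G p)) (∧-zeroʳ _)
  }

module _ (G : Graph) {R : V G → V G → Set} (R? : Decidable₂ R) (R-sym : Symmetric R) where

  private
    G′ = deleteEdges G R? R-sym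

  deleteEdges-⊆ : ∀ {p q} → Edge G′ p q → Edge G p q
  deleteEdges-⊆ {p} {q} e with R? p q
  ... | no _ = e

  deleteEdges-¬R : ∀ {p q} → ¬ R p q → adj G′ p q ≡ adj G p q
  deleteEdges-¬R {p} {q} ¬Rpq rewrite dec-false (R? p q) ¬Rpq = refl

  deleteEdges-R : ∀ {p q} → R p q → ¬ Edge G′ p q
  deleteEdges-R {p} {q} Rpq rewrite dec-true (R? p q) Rpq = λ ()

  deleteEdges-minor : Minor G′ G
  deleteEdges-minor = record
    { φ        = just
    ; nonempty = λ h → h , refl
    ; conn     = singleton-connected
    ; edge     = λ h h′ e → h , h′ , refl , refl , deleteEdges-⊆ e
    }
    where
    singleton-connected : ∀ h → ConnectedOn G (λ v → just v ≡ just h)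
    singleton-connected h u v refl refl = here refl

  deleteEdges-proper : ∀ {u v} → Edge G u v → R u v → ProperMinor G′ G
  deleteEdges-proper e Ruv = deleteEdges-minor , λ G≅G′ →
    <-irrefl refl (≤-<-trans (edgeCount-↪ (InducedOn⇒↪ G≅G′)) fewer-edges)
    where
    fewer-edges : edgeCount G′ < edgeCount G
    fewer-edges = count-< (EdgeCode? G′) (EdgeCode? G) deleteEdges-⊆
      (EdgeCode-combine⁺ G e) (deleteEdges-R Ruv ∘ EdgeCode-combine⁻ G′)

Between : (G : Graph) → V G → (V G → Set) → V G → V G → Set
Between G x D p q = (p ≡ x × D q) ⊎ (q ≡ x × D p)

between? : (G : Graph) (x : V G) {D : V G → Set} → Decidable D → Decidable₂ (Between G x D)
between? G x D? p q = ((p ≟ x) ×-dec D? q) ⊎-dec ((q ≟ x) ×-dec D? p)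

detach : (G : Graph) (x : V G) {D : V G → Set} → Decidable D → Graph
detach G x D? = deleteEdges G (between? G x D?) swap

detach-proper : (G : Graph) (x : V G) {D : V G → Set} (D? : Decidable D) →
  ∀ {y} → Edge G x y → D y → ProperMinor (detach G x D?) G
detach-proper G x D? x—y Dy = deleteEdges-proper G (between? G x D?) swap x—y (inj₁ (refl , Dy))

-- Gluing apex sets along a cut vertex

1-separation-closed : ∀ {𝓗 : GraphClass} → ClosedUnder1CliqueSums 𝓗 →
  ∀ {G H₁ H₂ : Graph} {P₁ P₂ : V G → Set} → Decidable P₂ →
  (∀ v → P₁ v ⊎ P₂ v) →
  (∀ {p q} → P₁ p → P₂ q → Edge G p q → P₂ p ⊎ P₁ q) →
  (∀ {u v} → P₁ u → P₂ u → P₁ v → P₂ v → u ≡ v) →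
  InducedOn H₁ G P₁ → InducedOn H₂ G P₂ → 𝓗 H₁ → 𝓗 H₂ → 𝓗 G
1-separation-closed {𝓗} (disjoint-closed , identification-closed) {G} {H₁} {H₂} {P₂ = P₂}
  P₂? covers crossing meet ι₁ ι₂ H₁∈𝓗 H₂∈𝓗 = glue (any? (λ a → P₂? (ι₁.f a)))
  where
  module ι₁ = InducedOn ι₁
  module ι₂ = InducedOn ι₂

  P₂-at : ∀ {a b} → ι₁.f a ≡ ι₂.f b → P₂ (ι₁.f a)
  P₂-at {b = b} eq = subst P₂ (sym eq) (ι₂.f-into b)

  union : Union H₁ H₂ G
  union = record
    { f₁ = ι₁.f ; f₂ = ι₂.f ; f₁-inj = ι₁.f-inj ; f₂-inj = ι₂.f-inj ; f₁-adj = ι₁.f-adj ; f₂-adj = ι₂.f-adj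
    ; cover = λ v → Sum.map (ι₁.f-onto v) (ι₂.f-onto v) (covers v)
    ; edges = λ a b e → swap (Sum.map (ι₂.f-onto _) (ι₁.f-onto _) (crossing (ι₁.f-into a) (ι₂.f-into b) e))
    }

  glue : Dec (∃[ a ] P₂ (ι₁.f a)) → 𝓗 G
  glue (no ¬shared) = disjoint-closed H₁ H₂ G H₁∈𝓗 H₂∈𝓗 (union , λ a b eq → ¬shared (a , P₂-at eq))
  glue (yes (a₀ , P₂a₀)) = identification-closed H₁ H₂ a₀ b₀ G H₁∈𝓗 H₂∈𝓗 (union , sym fb₀≡fa₀ , unique)
    where
    b₀ = proj₁ (ι₂.f-onto _ P₂a₀)
    fb₀≡fa₀ = proj₂ (ι₂.f-onto _ P₂a₀)
    unique : ∀ a b → ι₁.f a ≡ ι₂.f b → (a ≡ a₀) × (b ≡ b₀)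
    unique a b eq =
      let fa≡fa₀ = meet (ι₁.f-into a) (P₂-at eq) (ι₁.f-into a₀) P₂a₀
      in ι₁.f-inj a a₀ fa≡fa₀ , ι₂.f-inj b b₀ (trans (sym eq) (trans fa≡fa₀ (sym fb₀≡fa₀)))

InducedSubgraphsIn : GraphClass → (G : Graph) → (V G → Set) → Set
InducedSubgraphsIn 𝓗 G S = ∀ {K} (e : K ↪ G) → (∀ a → S (embed e a)) → 𝓗 K

module _ {𝓗 : GraphClass} (iso : IsoClosed 𝓗) (her : Hereditary 𝓗) {G : Graph} {x : V G} where

  detached-solution-side : ∀ {D Q : V G → Set} (D? : Decidable D) {X Y : List (V G)} {T : Graph} →
    InducedOn T (detach G x D?) (_∉ X) → 𝓗 T →
    (∀ {p q} → Q p → Q q → ¬ (p ≡ x × D q)) → (∀ {z} → Q z → z ∈ X → z ∈ Y) →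
    InducedSubgraphsIn 𝓗 G (λ z → Q z × z ∉ Y)
  detached-solution-side D? ι T∈𝓗 untouched X∩Q⊆Y e image⊆ =
    ↪-closed iso her (↪-factor e′ ι (λ a z∈X → proj₂ (image⊆ a) (X∩Q⊆Y (proj₁ (image⊆ a)) z∈X))) T∈𝓗
    where
    e′ : _ ↪ detach G x D?
    e′ = record
      { embed           = embed e
      ; embed-injective = embed-injective e
      ; embed-adj       = λ a b → let Qa = proj₁ (image⊆ a) ; Qb = proj₁ (image⊆ b) in
          trans (embed-adj e a b) (sym (deleteEdges-¬R G (between? G x D?) swap [ untouched Qa Qb , untouched Qb Qa ]))
      }

∖-in-𝓗 : ∀ {𝓗 : GraphClass} → ClosedUnder1CliqueSums 𝓗 →
  ∀ {G : Graph} {Q₁ Q₂ : V G → Set} (Q₁? : Decidable Q₁) (Q₂? : Decidable Q₂) {Y : List (V G)} →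
  (∀ {z} → z ∉ Y → Q₁ z ⊎ Q₂ z) →
  (∀ {p q} → Q₁ p → Q₂ q → Edge G p q → Q₂ p ⊎ Q₁ q) →
  (∀ {u v} → Q₁ u → Q₂ u → Q₁ v → Q₂ v → u ≡ v) →
  InducedSubgraphsIn 𝓗 G (λ z → Q₁ z × z ∉ Y) → InducedSubgraphsIn 𝓗 G (λ z → Q₂ z × z ∉ Y) →
  𝓗 (G ∖ Y)
∖-in-𝓗 {𝓗} cs {G} Q₁? Q₂? {Y} covers crossing meet side₁ side₂ =
  1-separation-closed cs (Q₂? ∘ f) (covers ∘ f-into) crossing
    (λ Q₁u Q₂u Q₁v Q₂v → f-inj _ _ (meet Q₁u Q₂u Q₁v Q₂v))
    (induced-InducedOn (G ∖ Y) (Q₁? ∘ f)) (induced-InducedOn (G ∖ Y) (Q₂? ∘ f))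
    (side-in-𝓗 Q₁? side₁) (side-in-𝓗 Q₂? side₂)
  where
  open InducedOn (∖-InducedOn G Y)
  side-in-𝓗 : ∀ {Q} (Q? : Decidable Q) → InducedSubgraphsIn 𝓗 G (λ z → Q z × z ∉ Y) →
    𝓗 (induced (G ∖ Y) (Q? ∘ f))
  side-in-𝓗 Q? side = side (↪-trans (InducedOn⇒↪ ι) (InducedOn⇒↪ (∖-InducedOn G Y)))
    (λ a → InducedOn.f-into ι a , f-into _)
    where ι = induced-InducedOn (G ∖ Y) (Q? ∘ f)

length-filter-∁ : ∀ {A : Set} {P : Pred A ℓ} (P? : Decidable P) xs →
  length (filter P? xs) + length (filter (∁? P?) xs) ≡ length xs
length-filter-∁ P? [] = refl
length-filter-∁ P? (x ∷ xs) with P? x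
... | yes _ = cong suc (length-filter-∁ P? xs)
... | no  _ = trans (+-suc _ _) (cong suc (length-filter-∁ P? xs))

a+b≤1+k+k⇒a≤k⊎b≤k : ∀ k {a b} → a + b ≤ suc (k + k) → a ≤ k ⊎ b ≤ k
a+b≤1+k+k⇒a≤k⊎b≤k k {a} {b} a+b≤ with a ≤? k
... | yes a≤k = inj₁ a≤k
... | no  a≰k = inj₂ (+-cancelˡ-≤ (suc k) b k (≤-trans (+-monoˡ-≤ b (≰⇒> a≰k)) a+b≤))

module Sides (G : Graph) (x : V G) {A : V G → Set} (A? : Decidable A) where

  A⁺ B : V G → Set
  A⁺ z = A z ⊎ z ≡ x
  B    = ∁ A⁺

  A⁺? : Decidable A⁺
  A⁺? z = A? z ⊎-dec (z ≟ x)

  B? : Decidable B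
  B? = ∁? A⁺?

  B-closed : ClosedAwayFrom G x A → ClosedAwayFrom G x B
  B-closed A-closed By e z≢x = [ (λ Az → By (inj₁ (A-closed Az (edge-sym G e) (By ∘ inj₂)))) , z≢x ]

module _ {𝓗 : GraphClass} (iso : IsoClosed 𝓗) (her : Hereditary 𝓗) (cs : ClosedUnder1CliqueSums 𝓗) (k : ℕ)
  (G : Graph) (x : V G) {A : V G → Set} (A? : Decidable A) (x∉A : ¬ A x) (A-closed : ClosedAwayFrom G x A) where

  open Sides G x A?

  Y₁ Y₂ : List (V G) → List (V G) → List (V G)
  Y₁ X₁ X₂ = filter A⁺? X₂ ++ filter (∁? A?) X₁
  Y₂ X₁ X₂ = x ∷ filter A? X₁ ++ filter B? X₂

  module _ {X₁ X₂ : List (V G)} {T₁ T₂ : Graph}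
    (ι₁ : InducedOn T₁ (detach G x A?) (_∉ X₁)) (T₁∈𝓗 : 𝓗 T₁)
    (ι₂ : InducedOn T₂ (detach G x B?) (_∉ X₂)) (T₂∈𝓗 : 𝓗 T₂) where

    ∖Y₁-in-𝓗 : 𝓗 (G ∖ Y₁ X₁ X₂)
    ∖Y₁-in-𝓗 = ∖-in-𝓗 cs A⁺? (∁? A?) covers crossing
      (λ A⁺u ¬Au A⁺v ¬Av → trans (A⁺∩∁A⊆x A⁺u ¬Au) (sym (A⁺∩∁A⊆x A⁺v ¬Av)))
      (detached-solution-side iso her B? ι₂ T₂∈𝓗 (λ A⁺p A⁺q (_ , Bq) → Bq A⁺q)
        (λ A⁺z z∈X₂ → ∈-++⁺ˡ (∈-filter⁺ A⁺? z∈X₂ A⁺z)))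
      (detached-solution-side iso her A? ι₁ T₁∈𝓗 (λ _ ¬Aq (_ , Aq) → ¬Aq Aq)
        (λ ¬Az z∈X₁ → ∈-++⁺ʳ (filter A⁺? X₂) (∈-filter⁺ (∁? A?) z∈X₁ ¬Az)))
      where
      covers : ∀ {z} → z ∉ Y₁ X₁ X₂ → A⁺ z ⊎ ¬ A z
      covers {z} _ with A? z
      ... | yes Az = inj₁ (inj₁ Az)
      ... | no ¬Az = inj₂ ¬Az
      crossing : ∀ {p q} → A⁺ p → ¬ A q → Edge G p q → ¬ A p ⊎ A⁺ q
      crossing {p} {q} _ ¬Aq e with A? p | q ≟ x
      ... | no ¬Ap | _       = inj₁ ¬Ap
      ... | yes _  | yes q≡x = inj₂ (inj₂ q≡x)
      ... | yes Ap | no q≢x  = ⊥-elim (¬Aq (A-closed Ap e q≢x))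
      A⁺∩∁A⊆x : ∀ {z} → A⁺ z → ¬ A z → z ≡ x
      A⁺∩∁A⊆x (inj₁ Az)  ¬Az = ⊥-elim (¬Az Az)
      A⁺∩∁A⊆x (inj₂ z≡x) _   = z≡x

    ∖Y₂-in-𝓗 : 𝓗 (G ∖ Y₂ X₁ X₂)
    ∖Y₂-in-𝓗 = ∖-in-𝓗 cs A? B? covers crossing (λ Au Bu _ _ → ⊥-elim (Bu (inj₁ Au)))
      (detached-solution-side iso her A? ι₁ T₁∈𝓗 (λ Ap _ (p≡x , _) → x∉A (subst A p≡x Ap))
        (λ Az z∈X₁ → Any.there (∈-++⁺ˡ (∈-filter⁺ A? z∈X₁ Az))))
      (detached-solution-side iso her B? ι₂ T₂∈𝓗 (λ Bp _ (p≡x , _) → Bp (inj₂ p≡x))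
        (λ Bz z∈X₂ → Any.there (∈-++⁺ʳ (filter A? X₁) (∈-filter⁺ B? z∈X₂ Bz))))
      where
      covers : ∀ {z} → z ∉ Y₂ X₁ X₂ → A z ⊎ B z
      covers {z} z∉Y₂ with A? z
      ... | yes Az = inj₁ Az
      ... | no ¬Az = inj₂ [ ¬Az , z∉Y₂ ∘ Any.here ]
      crossing : ∀ {p q} → A p → B q → Edge G p q → B p ⊎ A q
      crossing Ap Bq e = inj₂ (A-closed Ap e (Bq ∘ inj₂))

  length-Y₁+Y₂ : ∀ X₁ X₂ → length (Y₁ X₁ X₂) + length (Y₂ X₁ X₂) ≡ suc (length X₁ + length X₂)
  length-Y₁+Y₂ X₁ X₂ = begin
    length (filter A⁺? X₂ ++ filter (∁? A?) X₁) + length (x ∷ filter A? X₁ ++ filter B? X₂)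
      ≡⟨ cong₂ _+_ (length-++ (filter A⁺? X₂)) (cong suc (length-++ (filter A? X₁))) ⟩
    (|X₂∩A⁺| + |X₁∖A|) + suc (|X₁∩A| + |X₂∩B|)
      ≡⟨ interchange |X₂∩A⁺| |X₁∖A| |X₁∩A| |X₂∩B| ⟩
    suc ((|X₁∩A| + |X₁∖A|) + (|X₂∩A⁺| + |X₂∩B|))
      ≡⟨ cong suc (cong₂ _+_ (length-filter-∁ A? X₁) (length-filter-∁ A⁺? X₂)) ⟩
    suc (length X₁ + length X₂) ∎
    where
    open ≡-Reasoning
    |X₁∩A|  = length (filter A? X₁)
    |X₁∖A|  = length (filter (∁? A?) X₁)
    |X₂∩A⁺| = length (filter A⁺? X₂)
    |X₂∩B|  = length (filter B? X₂)
    interchange : ∀ a b c d → (a + b) + suc (c + d) ≡ suc ((c + b) + (a + d))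
    interchange = solve 4 (λ a b c d → (a :+ b) :+ (con 1 :+ (c :+ d)) := con 1 :+ ((c :+ b) :+ (a :+ d))) refl
      where open +-*-Solver

  Apex-from-detached-sides : Apex 𝓗 k (detach G x A?) → Apex 𝓗 k (detach G x B?) → Apex 𝓗 k G
  Apex-from-detached-sides (X₁ , |X₁|≤k , T₁ , ι₁ , T₁∈𝓗) (X₂ , |X₂|≤k , T₂ , ι₂ , T₂∈𝓗)
    with a+b≤1+k+k⇒a≤k⊎b≤k k
           (subst (_≤ suc (k + k)) (sym (length-Y₁+Y₂ X₁ X₂)) (s≤s (+-mono-≤ |X₁|≤k |X₂|≤k)))
  ... | inj₁ |Y₁|≤k = Y₁ X₁ X₂ , |Y₁|≤k , _ , ∖-InducedOn G _ , ∖Y₁-in-𝓗 ι₁ T₁∈𝓗 ι₂ T₂∈𝓗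
  ... | inj₂ |Y₂|≤k = Y₂ X₁ X₂ , |Y₂|≤k , _ , ∖-InducedOn G _ , ∖Y₂-in-𝓗 ι₁ T₁∈𝓗 ι₂ T₂∈𝓗

module _ {𝓗 : GraphClass} (iso : IsoClosed 𝓗) (her : Hereditary 𝓗) (cs : ClosedUnder1CliqueSums 𝓗)
  {k : ℕ} {G : Graph} (obstruction : MinorObstruction (Apex 𝓗 k) G) where

  no-1-separation : ∀ {x A} (A? : Decidable A) → ¬ A x → ClosedAwayFrom G x A →
    ∃[ y ] A y × Edge G x y → ∃[ y ] Sides.B G x A? y × Edge G x y → ⊥
  no-1-separation {x} A? x∉A A-closed (_ , Ay₁ , x—y₁) (_ , By₂ , x—y₂) =
    proj₁ obstruction (Apex-from-detached-sides iso her cs k G x A? x∉A A-closed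
      (proj₂ obstruction _ (detach-proper G x A? x—y₁ Ay₁))
      (proj₂ obstruction _ (detach-proper G x B? x—y₂ By₂)))
    where open Sides G x A?

  component-∖-vertex-connected : ∀ {C} → IsComponent G C → ∀ {x u w} → C x → C u → C w → u ≢ x → w ≢ x →
    Reach G (λ z → z ≢ x × C z) u w
  component-∖-vertex-connected {C} (_ , connected , C-closed) {x} {u} {w} Cx Cu Cw u≢x w≢x =
    decide (reach? G ≢x? u w)
    where
    ≢x? : Decidable (_≢ x)
    ≢x? z = ¬? (z ≟ x)
    A? = reach? G ≢x? u
    open Sides G x A?
    x∉A : ¬ Reach G (_≢ x) u x
    x∉A u⇝x = reach-end u⇝x refl
    decide : Dec (Reach G (_≢ x) u w) → Reach G (λ z → z ≢ x × C z) u w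
    decide (yes u⇝w) = reach-∩ C-closed Cu u⇝w
    decide (no ¬u⇝w) = ⊥-elim (no-1-separation A? x∉A step
      (exit-neighbour x∉A step (connected x u Cx Cu) (here u≢x))
      (exit-neighbour (λ Bx → Bx (inj₂ refl)) (B-closed step) (connected x w Cx Cw) [ ¬u⇝w , w≢x ]))

lemma4p5 : (𝓗 : GraphClass) → IsoClosed 𝓗 → Hereditary 𝓗 → ClosedUnder1CliqueSums 𝓗 →
    (k : ℕ) (G : Graph) → MinorObstruction (Apex 𝓗 k) G →
    (C : V G → Set) → IsComponent G C →
    (H : Graph) → InducedOn H G C → TwoConnected H
lemma4p5 𝓗 iso her cs k G obstruction C component H ι [] _ u w _ _ =
  reach-pullback ι id (λ _ ()) (proj₁ (proj₂ component) _ _ (f-into u) (f-into w))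
  where open InducedOn ι
lemma4p5 𝓗 iso her cs k G obstruction C component H ι (x ∷ []) _ u w u∉X w∉X =
  reach-pullback ι proj₂ (λ { (fa≢fx , _) (Any.here a≡x) → fa≢fx (cong f a≡x) })
    (component-∖-vertex-connected iso her cs obstruction component (f-into x) (f-into u) (f-into w)
      (u∉X ∘ Any.here ∘ f-inj u x) (w∉X ∘ Any.here ∘ f-inj w x))
  where open InducedOn ι
lemma4p5 _ _ _ _ _ _ _ _ _ _ _ (_ ∷ _ ∷ _) (s≤s ()) _ _ _ _
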